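{- Let $n\ge1$, $p$ a prime, and $R\subsetneq E_n$. The vectors $\lambda^{(i)}_k$ ($1\le i\le h$, $1\le k\le g_i$) form a basis of $\mathbb{Q}^n$.
   Context: $E_n=\{1,\dots,n\}$, indices mod $n$, $e_m$ the standard basis of $\mathbb{Z}^n$ extended $n$-periodically to $m\in\mathbb{Z}$. Write $E_n\setminus R=\{r_1,\dots,r_h\}$ ($h=n-|R|\ge1$) so that $r_{i+1}$ is the first element of $E_n\setminus R$ in the sequence $r_i+1,r_i+2,\dots$ (mod $n$), with $r_{h+1}=r_1$, $r_0=r_h$. Let $g_i$ be the smallest positive integer with $r_{i-1}+g_i\equiv r_i\pmod n$ (so $\sum_i g_i=n$). Define $\lambda^{(i)}_k=e_{r_i}+p^ke_{r_i-k}$ for $1\le k\le g_i-1$ and $\lambda^{(i)}_{g_i}=e_{r_i}-p^{g_i}e_{r_{i-1}}$. -}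

module Defs where

open import Data.Nat using (ℕ; zero; suc; _+_; _∸_; _^_; NonZero)
open import Data.Nat.DivMod using (_%_; m%n<n)
open import Data.Fin using (Fin; toℕ; fromℕ<; _≟_)
open import Data.Fin.Subset using (Subset; _∉_)
open import Data.Vec using (lookup)
open import Data.Bool using (Bool; true; false; if_then_else_)
open import Data.List using (List; []; _∷_; _++_; length; concatMap; upTo; map; allFin)
open import Data.Integer using (+_)
open import Data.Rational using (ℚ; 0ℚ; 1ℚ; _/_) renaming (_+_ to _+ℚ_; _*_ to _*ℚ_; _-_ to _-ℚ_)
open import Data.Product using (Σ; _×_; ∃)
open import Relation.Nullary using (does)
open import Relation.Binary.PropositionalEquality using (_≡_)

-- E_n = {1,…,n} is modelled by Fin n = {0,…,n-1} (shift by one; the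
-- cyclic structure mod n is the same).

-- the index (r - k) mod n, for 0 ≤ k ≤ n
_⊖_ : {n : ℕ} .{{_ : NonZero n}} → Fin n → ℕ → Fin n
_⊖_ {n} r k = fromℕ< (m%n<n (toℕ r + n ∸ k) n)

e : {n : ℕ} → Fin n → Fin n → ℚ
e m j = if does (j ≟ m) then 1ℚ else 0ℚ

pow : ℕ → ℕ → ℚ
pow p k = (+ (p ^ k)) / 1

_⊕_ : {n : ℕ} → (Fin n → ℚ) → (Fin n → ℚ) → Fin n → ℚ
(u ⊕ v) j = u j +ℚ v j

_⊛_ : {n : ℕ} → ℚ → (Fin n → ℚ) → Fin n → ℚ
(a ⊛ v) j = a *ℚ v j

_⊝_ : {n : ℕ} → (Fin n → ℚ) → (Fin n → ℚ) → Fin n → ℚ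
(u ⊝ v) j = u j -ℚ v j

-- gap R r : for r ∉ R, the smallest positive g with (r - g) mod n ∉ R
-- (this is g_i when r = r_i, since then r_{i-1} = r_i - g_i).
-- Searches g = 1, 2, …, n-1 and returns n otherwise (r - n ≡ r ∉ R).
gap : {n : ℕ} .{{_ : NonZero n}} → Subset n → Fin n → ℕ
gap {n} R r = search (n ∸ 1) 1
  where
  search : ℕ → ℕ → ℕ
  search zero    g = g
  search (suc f) g = if lookup R (r ⊖ g) then search f (suc g) else g

-- λ_k attached to the element r ∉ R (r = r_i), for 1 ≤ k ≤ g = gap R r:
--   k < g : e_r + p^k e_{r-k};   k = g : e_r - p^g e_{r-g} (= e_r - p^g e_{r_{i-1}})
lam : {n : ℕ} .{{_ : NonZero n}} → ℕ → Subset n → Fin n → ℕ → Fin n → ℚ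
lam p R r k =
  if does (k Data.Nat.≟ gap R r)
  then e r ⊝ (pow p k ⊛ e (r ⊖ k))
  else e r ⊕ (pow p k ⊛ e (r ⊖ k))

-- the list of all λ^{(i)}_k, 1 ≤ i ≤ h, 1 ≤ k ≤ g_i
-- (r runs over E_n \ R, k over 1..gap R r)
lambdas : (n : ℕ) .{{_ : NonZero n}} → ℕ → Subset n → List (Fin n → ℚ)
lambdas n p R = concatMap block (allFin n)
  where
  block : Fin n → List (Fin n → ℚ)
  block r = if lookup R r then []
            else map (λ k → lam p R r (suc k)) (upTo (gap R r))

lincomb : {n : ℕ} → (L : List (Fin n → ℚ)) → (Fin (length L) → ℚ) → Fin n → ℚ
lincomb []      c j = 0ℚ
lincomb (v ∷ L) c j = c Data.Fin.zero *ℚ v j +ℚ lincomb L (λ i → c (Data.Fin.suc i)) j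

LinIndep : {n : ℕ} → List (Fin n → ℚ) → Set
LinIndep L = ∀ c → (∀ j → lincomb L c j ≡ 0ℚ) → ∀ i → c i ≡ 0ℚ

Spans : {n : ℕ} → List (Fin n → ℚ) → Set
Spans {n} L = ∀ (v : Fin n → ℚ) → ∃ λ c → ∀ j → lincomb L c j ≡ v j

IsBasis : {n : ℕ} → List (Fin n → ℚ) → Set
IsBasis L = LinIndep L × Spans L

{-# OPTIONS --safe #-}
module Submission where

-- Every j ∈ E_n lies in exactly one block {r − k : r ∉ R, 0 ≤ k < gap r}, so there
-- are at most n vectors λ, and a spanning family of at most n vectors of ℚⁿ is a
-- basis. Within the block of r, (λ_k − λ_{k+1}) / (±p^k) = e_{r−k} ∓ p e_{r−k−1},
-- where λ_0 := e_r − e_r = 0; hence the span contains e_j − a_j e_{j−1} with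
-- a_j = ±p for every j. Chaining these once around the cycle puts
-- e_j − (±pⁿ) e_j in the span, and 1 ∓ pⁿ ≠ 0 because p > 1.

open import Defs
open import Data.Nat using (ℕ; NonZero)
open import Data.Nat.Primality using (Prime)
open import Data.Fin using (Fin)
open import Data.Fin.Subset using (Subset; _∉_)
open import Data.Product using (∃)

open import Data.Bool using (Bool; true; false; if_then_else_)
open import Data.Fin using (zero; suc; toℕ; cast)
open import Data.Fin.Properties using (toℕ-fromℕ<; toℕ-injective; toℕ<n; injective⇒≤)
import Data.Integer as ℤ
import Data.Integer.Properties as ℤ
open import Data.List using (List; []; _∷_; _++_; length; map; concatMap; upTo; applyUpTo; allFin)
import Data.List as List
open import Data.List.Properties
  using (length-++; length-map; length-upTo; length-applyUpTo; length-removeAt′)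
open import Data.List.Membership.Propositional using (_∈_)
open import Data.List.Membership.Propositional.Properties
  using (∈-lookup; ∈-applyUpTo⁻; ∈-map⁺; ∈-upTo⁺; ∈-allFin; ∈-concat⁺′)
open import Data.List.Relation.Binary.Disjoint.Propositional using (Disjoint)
open import Data.List.Relation.Unary.Any using (here; there)
import Data.List.Relation.Unary.All as All
import Data.List.Relation.Unary.All.Properties as All
open import Data.List.Relation.Unary.AllPairs using ([]; _∷_)
import Data.List.Relation.Unary.AllPairs as AllPairs
import Data.List.Relation.Unary.AllPairs.Properties as AllPairs
open import Data.List.Relation.Unary.Unique.Propositional using (Unique)
open import Data.List.Relation.Unary.Unique.Propositional.Properties using (applyUpTo⁺₁; concat⁺; allFin⁺)
open import Data.Nat using (zero; suc; _≤_; _<_; z≤n; s≤s; >-nonZero; >-nonZero⁻¹; nonTrivial⇒n>1)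
import Data.Nat as ℕ
open import Data.Nat.Coprimality using (1-coprimeTo) renaming (sym to coprime-sym)
open import Data.Nat.DivMod using (%-distribˡ-+; m%n%n≡m%n; m<n⇒m%n≡m; [m+n]%n≡m%n)
open import Data.Nat.Primality using (prime⇒nonTrivial)
open import Data.Nat.Properties
open import Data.Product using (_×_; _,_; ∃₂; proj₁; proj₂)
import Data.Product as Product
import Data.Rational as ℚ
open import Data.Rational using (ℚ; mkℚ; ↥_; 0ℚ; 1ℚ; _/_; ≢-nonZero)
import Data.Rational.Properties as ℚ
open import Algebra.Properties.Group ℚ.+-0-group using (inverseˡ-unique; x∙y⁻¹≈ε⇒x≈y)
open import Data.Rational.Solver using (module +-*-Solver)
open +-*-Solver using (solve; _:+_; _:*_; _:-_; :-_; _:=_; con)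
open import Algebra.Properties.Monoid.Sum ℚ.+-0-monoid using (sum-syntax)
open import Data.Sum using (_⊎_; inj₁; inj₂)
open import Data.Vec using (lookup)
open import Data.Vec.Properties using (lookup⇒[]=)
open import Data.Vec.Functional using (Vector)
import Data.Vec.Functional as Vector
open import Function using (_∘_; id)
open import Relation.Binary.Definitions using (tri<; tri≈; tri>)
open import Relation.Binary.PropositionalEquality
open import Relation.Nullary using (yes; no; does; contradiction)

keptIndex : ∀ {A : Set} (xs : List A) (i : Fin (length xs)) →
            Fin (length (List.removeAt xs i)) → Fin (length xs)
keptIndex (x ∷ xs) zero    k       = suc k
keptIndex (x ∷ xs) (suc i) zero    = zero
keptIndex (x ∷ xs) (suc i) (suc k) = suc (keptIndex xs i k)

Unique⇒lookup-injective : ∀ {A : Set} {xs : List A} → Unique xs →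
                          ∀ {i j} → List.lookup xs i ≡ List.lookup xs j → i ≡ j
Unique⇒lookup-injective (_ ∷ _)      {zero}  {zero}  _  = refl
Unique⇒lookup-injective (x∉xs ∷ _)   {zero}  {suc j} eq = contradiction eq (All.lookup x∉xs (∈-lookup j))
Unique⇒lookup-injective (x∉xs ∷ _)   {suc i} {zero}  eq = contradiction (sym eq) (All.lookup x∉xs (∈-lookup i))
Unique⇒lookup-injective (_ ∷ xs!)    {suc i} {suc j} eq = cong suc (Unique⇒lookup-injective xs! eq)

Unique⇒length≤ : ∀ {m} {xs : List (Fin m)} → Unique xs → length xs ≤ m
Unique⇒length≤ xs! = injective⇒≤ (Unique⇒lookup-injective xs!)

length-concatMap-cong : ∀ {A B C : Set} {f : A → List B} {g : A → List C} →
                        (∀ x → length (f x) ≡ length (g x)) →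
                        ∀ xs → length (concatMap f xs) ≡ length (concatMap g xs)
length-concatMap-cong          f≈g []       = refl
length-concatMap-cong {f = f} {g} f≈g (x ∷ xs) = begin
  length (f x ++ concatMap f xs)            ≡⟨ length-++ (f x) ⟩
  length (f x) ℕ.+ length (concatMap f xs)  ≡⟨ cong₂ ℕ._+_ (f≈g x) (length-concatMap-cong f≈g xs) ⟩
  length (g x) ℕ.+ length (concatMap g xs)  ≡⟨ length-++ (g x) ⟨
  length (g x ++ concatMap g xs)            ∎
  where open ≡-Reasoning

module _ {n : ℕ} .{{_ : NonZero n}} where

  open import Data.Nat using (_+_; _∸_; _%_)

  private
    [m%n+k]%n≡[m+k]%n : ∀ m k → (m % n + k) % n ≡ (m + k) % n
    [m%n+k]%n≡[m+k]%n m k = begin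
      (m % n + k) % n          ≡⟨ %-distribˡ-+ (m % n) k n ⟩
      (m % n % n + k % n) % n  ≡⟨ cong (λ a → (a + k % n) % n) (m%n%n≡m%n m n) ⟩
      (m % n + k % n) % n      ≡⟨ %-distribˡ-+ m k n ⟨
      (m + k) % n              ∎
      where open ≡-Reasoning

    toℕ%n : (y : Fin n) → toℕ y % n ≡ toℕ y
    toℕ%n y = m<n⇒m%n≡m (toℕ<n y)

  ⊖-inverse : ∀ (r : Fin n) {k} → k ≤ n → (toℕ (r ⊖ k) + k) % n ≡ toℕ r
  ⊖-inverse r {k} k≤n = begin
    (toℕ (r ⊖ k) + k) % n          ≡⟨ cong (λ a → (a + k) % n) (toℕ-fromℕ< _) ⟩
    ((toℕ r + n ∸ k) % n + k) % n  ≡⟨ [m%n+k]%n≡[m+k]%n (toℕ r + n ∸ k) k ⟩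
    (toℕ r + n ∸ k + k) % n        ≡⟨ cong (_% n) (m∸n+n≡m (≤-trans k≤n (m≤n+m n (toℕ r)))) ⟩
    (toℕ r + n) % n                ≡⟨ [m+n]%n≡m%n (toℕ r) n ⟩
    toℕ r % n                      ≡⟨ toℕ%n r ⟩
    toℕ r                          ∎
    where open ≡-Reasoning

  ⊖-unique : ∀ (r y : Fin n) {k} → k ≤ n → (toℕ y + k) % n ≡ toℕ r → y ≡ r ⊖ k
  ⊖-unique r y {k} k≤n y+k≡r = toℕ-injective (sym (begin
    toℕ (r ⊖ k)                              ≡⟨ toℕ-fromℕ< _ ⟩
    (toℕ r + n ∸ k) % n                      ≡⟨ cong (λ a → (a + n ∸ k) % n) y+k≡r ⟨
    ((toℕ y + k) % n + n ∸ k) % n            ≡⟨ cong (_% n) (+-∸-assoc ((toℕ y + k) % n) k≤n) ⟩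
    ((toℕ y + k) % n + (n ∸ k)) % n          ≡⟨ [m%n+k]%n≡[m+k]%n (toℕ y + k) (n ∸ k) ⟩
    (toℕ y + k + (n ∸ k)) % n                ≡⟨ cong (_% n) (+-assoc (toℕ y) k (n ∸ k)) ⟩
    (toℕ y + (k + (n ∸ k))) % n              ≡⟨ cong (λ a → (toℕ y + a) % n) (m+[n∸m]≡n k≤n) ⟩
    (toℕ y + n) % n                          ≡⟨ [m+n]%n≡m%n (toℕ y) n ⟩
    toℕ y % n                                ≡⟨ toℕ%n y ⟩
    toℕ y                                    ∎))
    where open ≡-Reasoning

  r⊖0≡r : ∀ (r : Fin n) → r ⊖ 0 ≡ r
  r⊖0≡r r = sym (⊖-unique r r z≤n (trans (cong (_% n) (+-identityʳ (toℕ r))) (toℕ%n r)))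

  r⊖n≡r : ∀ (r : Fin n) → r ⊖ n ≡ r
  r⊖n≡r r = sym (⊖-unique r r ≤-refl (trans ([m+n]%n≡m%n (toℕ r) n) (toℕ%n r)))

  ⊖-⊖ : ∀ (r : Fin n) a b → b + a ≤ n → (r ⊖ a) ⊖ b ≡ r ⊖ (b + a)
  ⊖-⊖ r a b b+a≤n = ⊖-unique r y b+a≤n (begin
    (toℕ y + (b + a)) % n      ≡⟨ cong (_% n) (+-assoc (toℕ y) b a) ⟨
    (toℕ y + b + a) % n        ≡⟨ [m%n+k]%n≡[m+k]%n (toℕ y + b) a ⟨
    ((toℕ y + b) % n + a) % n  ≡⟨ cong (λ c → (c + a) % n) (⊖-inverse (r ⊖ a) (≤-trans (m≤m+n b a) b+a≤n)) ⟩
    (toℕ (r ⊖ a) + a) % n      ≡⟨ ⊖-inverse r (≤-trans (m≤n+m a b) b+a≤n) ⟩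
    toℕ r                      ∎)
    where
    open ≡-Reasoning
    y = (r ⊖ a) ⊖ b

  ⊖-cancelʳ : ∀ (y z : Fin n) {b} → b ≤ n → y ⊖ b ≡ z ⊖ b → y ≡ z
  ⊖-cancelʳ y z {b} b≤n eq = toℕ-injective (begin
    toℕ y                   ≡⟨ ⊖-inverse y b≤n ⟨
    (toℕ (y ⊖ b) + b) % n   ≡⟨ cong (λ w → (toℕ w + b) % n) eq ⟩
    (toℕ (z ⊖ b) + b) % n   ≡⟨ ⊖-inverse z b≤n ⟩
    toℕ z                   ∎)
    where open ≡-Reasoning

  ⊖-surjective : ∀ (x j : Fin n) → ∃ λ d → d ≤ n × j ≡ x ⊖ d
  ⊖-surjective x j = d , <⇒≤ (toℕ<n (x ⊖ toℕ j)) ,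
    ⊖-unique x j (<⇒≤ (toℕ<n (x ⊖ toℕ j)))
      (trans (cong (_% n) (+-comm (toℕ j) d)) (⊖-inverse x (<⇒≤ (toℕ<n j))))
    where d = toℕ (x ⊖ toℕ j)

module LinearSearch (P : ℕ → Bool) where

  open import Data.Nat using (_+_)

  search : ℕ → ℕ → ℕ
  search zero    g = g
  search (suc f) g = if P g then search f (suc g) else g

  search-unique : (G : ℕ → ℕ → ℕ) → (∀ g → G zero g ≡ g) →
                  (∀ f g → G (suc f) g ≡ (if P g then G f (suc g) else g)) →
                  ∀ f g → G f g ≡ search f g
  search-unique G G-zero G-suc zero    g = G-zero g
  search-unique G G-zero G-suc (suc f) g =
    trans (G-suc f g) (cong (λ s → if P g then s else g) (search-unique G G-zero G-suc f (suc g)))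

  g≤search : ∀ f g → g ≤ search f g
  g≤search zero    g = ≤-refl
  g≤search (suc f) g with P g
  ... | true  = ≤-trans (n≤1+n g) (g≤search f (suc g))
  ... | false = ≤-refl

  search≤g+f : ∀ f g → search f g ≤ g + f
  search≤g+f zero    g = m≤m+n g 0
  search≤g+f (suc f) g with P g
  ... | true  = ≤-trans (search≤g+f f (suc g)) (≤-reflexive (sym (+-suc g f)))
  ... | false = m≤m+n g (suc f)

  search-skips : ∀ f g {k} → g ≤ k → k < search f g → P k ≡ true
  search-skips zero    g g≤k k<g = contradiction g≤k (<⇒≱ k<g)
  search-skips (suc f) g g≤k k<s with P g in Pg
  ... | false = contradiction g≤k (<⇒≱ k<s)
  ... | true with m≤n⇒m<n∨m≡n g≤k
  ...   | inj₁ g<k  = search-skips f (suc g) g<k k<s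
  ...   | inj₂ refl = Pg

  search-finds : ∀ f g → search f g < g + f → P (search f g) ≡ false
  search-finds zero    g s<g+0 = contradiction (sym (+-identityʳ g)) (<⇒≢ s<g+0)
  search-finds (suc f) g s<g+f with P g in Pg
  ... | false = Pg
  ... | true  = search-finds f (suc g) (<-≤-trans s<g+f (≤-reflexive (+-suc g f)))

module _ {n : ℕ} .{{_ : NonZero n}} (R : Subset n) (r : Fin n) where

  open import Data.Nat using (_+_; _∸_)

  open LinearSearch (λ g → lookup R (r ⊖ g))

  -- The search inside gap is local to Defs, so it can only be reached by
  -- unification, which needs its arguments n ∸ 1 and 1 abstracted first.
  gap≡search : gap R r ≡ search (n ∸ 1) 1
  gap≡search with search-unique _ (λ _ → refl) (λ _ _ → refl)
  ... | G≗search with n ∸ 1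
  ... | f with 1
  ... | g = G≗search f g

  private
    1+[n∸1]≡n : 1 + (n ∸ 1) ≡ n
    1+[n∸1]≡n = m+[n∸m]≡n (>-nonZero⁻¹ n)

  1≤gap : 1 ≤ gap R r
  1≤gap = subst (1 ≤_) (sym gap≡search) (g≤search (n ∸ 1) 1)

  gap≤n : gap R r ≤ n
  gap≤n = subst₂ _≤_ (sym gap≡search) 1+[n∸1]≡n (search≤g+f (n ∸ 1) 1)

  gap-skips : ∀ {k} → 1 ≤ k → k < gap R r → lookup R (r ⊖ k) ≡ true
  gap-skips 1≤k k<gap = search-skips (n ∸ 1) 1 1≤k (subst (_ <_) gap≡search k<gap)

  gap-stops : lookup R r ≡ false → lookup R (r ⊖ gap R r) ≡ false
  gap-stops r∉R with m≤n⇒m<n∨m≡n gap≤n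
  ... | inj₁ gap<n = subst (λ k → lookup R (r ⊖ k) ≡ false) (sym gap≡search)
                       (search-finds (n ∸ 1) 1 (subst₂ _<_ gap≡search (sym 1+[n∸1]≡n) gap<n))
  ... | inj₂ gap≡n = begin
    lookup R (r ⊖ gap R r) ≡⟨ cong (λ k → lookup R (r ⊖ k)) gap≡n ⟩
    lookup R (r ⊖ n)       ≡⟨ cong (lookup R) (r⊖n≡r r) ⟩
    lookup R r             ≡⟨ r∉R ⟩
    false                  ∎
    where open ≡-Reasoning

module _ {n : ℕ} .{{_ : NonZero n}} (R : Subset n) where

  open import Data.Nat using (_+_; _∸_)

  InBlock : Fin n → Set
  InBlock j = ∃₂ λ r k → lookup R r ≡ false × k < gap R r × j ≡ r ⊖ k

  inBlock-⊖ : ∀ {x} → lookup R x ≡ false → ∀ d → d ≤ n → InBlock (x ⊖ d)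
  inBlock-⊖ {x} x∉R zero    _    = x , 0 , x∉R , 1≤gap R x , refl
  inBlock-⊖ {x} x∉R (suc d) 1+d≤n with lookup R (x ⊖ suc d) in R[x⊖1+d]
  ... | false = x ⊖ suc d , 0 , R[x⊖1+d] , 1≤gap R _ , sym (r⊖0≡r _)
  ... | true with inBlock-⊖ x∉R d (≤-trans (n≤1+n d) 1+d≤n)
  ...   | r , k , r∉R , k<gap , x⊖d≡r⊖k = r , suc k , r∉R , 1+k<gap , x⊖1+d≡r⊖1+k
    where
    x⊖1+d≡r⊖1+k : x ⊖ suc d ≡ r ⊖ suc k
    x⊖1+d≡r⊖1+k = begin
      x ⊖ suc d        ≡⟨ ⊖-⊖ x d 1 1+d≤n ⟨
      (x ⊖ d) ⊖ 1      ≡⟨ cong (_⊖ 1) x⊖d≡r⊖k ⟩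
      (r ⊖ k) ⊖ 1      ≡⟨ ⊖-⊖ r k 1 (≤-trans k<gap (gap≤n R r)) ⟩
      r ⊖ suc k        ∎
      where open ≡-Reasoning
    1+k<gap : suc k < gap R r
    1+k<gap = ≤∧≢⇒< k<gap λ 1+k≡gap → contradiction (begin
      true                   ≡⟨ R[x⊖1+d] ⟨
      lookup R (x ⊖ suc d)   ≡⟨ cong (lookup R) x⊖1+d≡r⊖1+k ⟩
      lookup R (r ⊖ suc k)   ≡⟨ cong (λ k → lookup R (r ⊖ k)) 1+k≡gap ⟩
      lookup R (r ⊖ gap R r) ≡⟨ gap-stops R r r∉R ⟩
      false                  ∎) λ ()
      where open ≡-Reasoning

  inBlock : ∀ {x} → lookup R x ≡ false → ∀ j → InBlock j
  inBlock {x} x∉R j with ⊖-surjective x j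
  ... | d , d≤n , refl = inBlock-⊖ x∉R d d≤n

  overlap⇒∈R : ∀ {r y a b} → a < b → b < gap R r → y ⊖ a ≡ r ⊖ b → lookup R y ≡ true
  overlap⇒∈R {r} {y} {a} {b} a<b b<gap y⊖a≡r⊖b =
    trans (cong (lookup R) y≡r⊖[b∸a]) (gap-skips R r (m<n⇒0<n∸m a<b) (≤-<-trans (m∸n≤m b a) b<gap))
    where
    b≤n : b ≤ n
    b≤n = ≤-trans (<⇒≤ b<gap) (gap≤n R r)
    y≡r⊖[b∸a] : y ≡ r ⊖ (b ∸ a)
    y≡r⊖[b∸a] = ⊖-cancelʳ y (r ⊖ (b ∸ a)) (≤-trans (<⇒≤ a<b) b≤n) (begin
      y ⊖ a                ≡⟨ y⊖a≡r⊖b ⟩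
      r ⊖ b                ≡⟨ cong (r ⊖_) (m+[n∸m]≡n (<⇒≤ a<b)) ⟨
      r ⊖ (a + (b ∸ a))    ≡⟨ ⊖-⊖ r (b ∸ a) a (subst (_≤ n) (sym (m+[n∸m]≡n (<⇒≤ a<b))) b≤n) ⟨
      (r ⊖ (b ∸ a)) ⊖ a    ∎)
      where open ≡-Reasoning

  block-injective : ∀ {r r' a b} → lookup R r ≡ false → lookup R r' ≡ false →
                    a < gap R r → b < gap R r' → r ⊖ a ≡ r' ⊖ b → r ≡ r' × a ≡ b
  block-injective {a = a} {b} r∉R r'∉R a<gap b<gap eq with <-cmp a b
  ... | tri< a<b _ _ = contradiction (trans (sym (overlap⇒∈R a<b b<gap eq)) r∉R) λ ()
  ... | tri≈ _ refl _ = ⊖-cancelʳ _ _ (≤-trans (<⇒≤ a<gap) (gap≤n R _)) eq , refl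
  ... | tri> _ _ b<a = contradiction (trans (sym (overlap⇒∈R b<a a<gap (sym eq))) r'∉R) λ ()

  blockPositions : Fin n → List (Fin n)
  blockPositions r = if lookup R r then [] else applyUpTo (r ⊖_) (gap R r)

  positions : List (Fin n)
  positions = concatMap blockPositions (allFin n)

  ∈-blockPositions⁻ : ∀ {r j} → j ∈ blockPositions r →
                      ∃ λ k → lookup R r ≡ false × k < gap R r × j ≡ r ⊖ k
  ∈-blockPositions⁻ {r} j∈ with lookup R r
  ... | false with k , k<gap , refl ← ∈-applyUpTo⁻ (r ⊖_) j∈ = k , refl , k<gap , refl

  blockPositions-unique : ∀ r → Unique (blockPositions r)
  blockPositions-unique r with lookup R r in r∉R
  ... | true  = []
  ... | false = applyUpTo⁺₁ (r ⊖_) (gap R r) λ i<j j<gap eq →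
    <⇒≢ i<j (proj₂ (block-injective r∉R r∉R (<-trans i<j j<gap) j<gap eq))

  blockPositions-disjoint : ∀ {r r'} → r ≢ r' → Disjoint (blockPositions r) (blockPositions r')
  blockPositions-disjoint r≢r' (j∈ , j∈')
    with a , r∉R , a<gap , refl ← ∈-blockPositions⁻ j∈
       | b , r'∉R , b<gap , eq ← ∈-blockPositions⁻ j∈'
    = r≢r' (proj₁ (block-injective r∉R r'∉R a<gap b<gap eq))

  positions-unique : Unique positions
  positions-unique = concat⁺ (All.map⁺ (All.universal blockPositions-unique (allFin n)))
                             (AllPairs.map⁺ (AllPairs.map blockPositions-disjoint (allFin⁺ n)))

open import Data.Rational using (_+_; _*_; _-_; -_; 1/_)

1/x*[x*y]≡y : ∀ x .{{_ : ℚ.NonZero x}} y → 1/ x * (x * y) ≡ y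
1/x*[x*y]≡y x y = begin
  1/ x * (x * y)   ≡⟨ ℚ.*-assoc (1/ x) x y ⟨
  (1/ x * x) * y   ≡⟨ cong (_* y) (ℚ.*-inverseˡ x) ⟩
  1ℚ * y           ≡⟨ ℚ.*-identityˡ y ⟩
  y                ∎
  where open ≡-Reasoning

c*x+s≡0⇒x≡-s/c : ∀ c .{{_ : ℚ.NonZero c}} x s → c * x + s ≡ 0ℚ → x ≡ - (1/ c) * s
c*x+s≡0⇒x≡-s/c c x s c*x+s≡0 = begin
  x                ≡⟨ 1/x*[x*y]≡y c x ⟨
  1/ c * (c * x)   ≡⟨ cong (1/ c *_) (inverseˡ-unique (c * x) s c*x+s≡0) ⟩
  1/ c * (- s)     ≡⟨ solve 2 (λ k s → k :* (:- s) := (:- k) :* s) refl (1/ c) s ⟩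
  - (1/ c) * s     ∎
  where open ≡-Reasoning

module _ {n : ℕ} where

  record InSpan (L : List (Vector ℚ n)) (v : Vector ℚ n) : Set where
    constructor _,_
    field
      coefficients : Fin (length L) → ℚ
      lincomb≗     : lincomb L coefficients ≗ v

  lincomb-0 : ∀ (L : List (Vector ℚ n)) → lincomb L (λ _ → 0ℚ) ≗ (λ _ → 0ℚ)
  lincomb-0 []      j = refl
  lincomb-0 (v ∷ L) j = begin
    0ℚ * v j + lincomb L (λ _ → 0ℚ) j ≡⟨ cong (0ℚ * v j +_) (lincomb-0 L j) ⟩
    0ℚ * v j + 0ℚ                     ≡⟨ solve 1 (λ x → con 0ℚ :* x :+ con 0ℚ := con 0ℚ) refl (v j) ⟩
    0ℚ                                ∎
    where open ≡-Reasoning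

  lincomb-+ : ∀ (L : List (Vector ℚ n)) c d → lincomb L (λ i → c i + d i) ≗ lincomb L c ⊕ lincomb L d
  lincomb-+ []      c d j = refl
  lincomb-+ (v ∷ L) c d j = begin
    (c zero + d zero) * v j + lincomb L (λ i → c (suc i) + d (suc i)) j
      ≡⟨ cong ((c zero + d zero) * v j +_) (lincomb-+ L (c ∘ suc) (d ∘ suc) j) ⟩
    (c zero + d zero) * v j + (lincomb L (c ∘ suc) j + lincomb L (d ∘ suc) j)
      ≡⟨ solve 5 (λ a b x s t → (a :+ b) :* x :+ (s :+ t) := (a :* x :+ s) :+ (b :* x :+ t))
           refl (c zero) (d zero) (v j) (lincomb L (c ∘ suc) j) (lincomb L (d ∘ suc) j) ⟩
    (c zero * v j + lincomb L (c ∘ suc) j) + (d zero * v j + lincomb L (d ∘ suc) j)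
      ∎
    where open ≡-Reasoning

  lincomb-* : ∀ (L : List (Vector ℚ n)) a c → lincomb L (λ i → a * c i) ≗ a ⊛ lincomb L c
  lincomb-* []      a c j = solve 1 (λ a → con 0ℚ := a :* con 0ℚ) refl a
  lincomb-* (v ∷ L) a c j = begin
    a * c zero * v j + lincomb L (λ i → a * c (suc i)) j
      ≡⟨ cong (a * c zero * v j +_) (lincomb-* L a (c ∘ suc) j) ⟩
    a * c zero * v j + a * lincomb L (c ∘ suc) j
      ≡⟨ solve 4 (λ a b x s → a :* b :* x :+ a :* s := a :* (b :* x :+ s))
           refl a (c zero) (v j) (lincomb L (c ∘ suc) j) ⟩
    a * (c zero * v j + lincomb L (c ∘ suc) j)
      ∎
    where open ≡-Reasoning

  lincomb-removeAt : ∀ (L : List (Vector ℚ n)) i c →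
                     lincomb L c ≗ (c i ⊛ List.lookup L i) ⊕ lincomb (List.removeAt L i) (c ∘ keptIndex L i)
  lincomb-removeAt (v ∷ L) zero    c j = refl
  lincomb-removeAt (v ∷ L) (suc i) c j = begin
    c zero * v j + lincomb L (c ∘ suc) j
      ≡⟨ cong (c zero * v j +_) (lincomb-removeAt L i (c ∘ suc) j) ⟩
    c zero * v j + (c (suc i) * List.lookup L i j + s)
      ≡⟨ solve 3 (λ a b s → a :+ (b :+ s) := b :+ (a :+ s))
           refl (c zero * v j) (c (suc i) * List.lookup L i j) s ⟩
    c (suc i) * List.lookup L i j + (c zero * v j + s)
      ∎
    where
    open ≡-Reasoning
    s = lincomb (List.removeAt L i) (c ∘ suc ∘ keptIndex L i) j

  lincomb≢0⇒∃lookup≢0 : ∀ (L : List (Vector ℚ n)) c j → lincomb L c j ≢ 0ℚ →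
                        ∃ λ i → List.lookup L i j ≢ 0ℚ
  lincomb≢0⇒∃lookup≢0 []      c j lc≢0 = contradiction refl lc≢0
  lincomb≢0⇒∃lookup≢0 (v ∷ L) c j lc≢0 with v j ℚ.≟ 0ℚ
  ... | no  vj≢0 = zero , vj≢0
  ... | yes vj≡0 = Product.map suc id (lincomb≢0⇒∃lookup≢0 L (c ∘ suc) j rest≢0)
    where
    rest≢0 : lincomb L (c ∘ suc) j ≢ 0ℚ
    rest≢0 rest≡0 = lc≢0 (begin
      c zero * v j + lincomb L (c ∘ suc) j  ≡⟨ cong₂ (λ x s → c zero * x + s) vj≡0 rest≡0 ⟩
      c zero * 0ℚ + 0ℚ                      ≡⟨ solve 1 (λ a → a :* con 0ℚ :+ con 0ℚ := con 0ℚ) refl (c zero) ⟩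
      0ℚ                                    ∎)
      where open ≡-Reasoning

  module _ {L : List (Vector ℚ n)} where

    ∀inSpan⇒spans : (∀ v → InSpan L v) → Spans L
    ∀inSpan⇒spans v∈ v = InSpan.coefficients (v∈ v) , InSpan.lincomb≗ (v∈ v)

    inSpan-resp : ∀ {u w} → u ≗ w → InSpan L u → InSpan L w
    inSpan-resp u≗w (c , lc≗u) = c , λ j → trans (lc≗u j) (u≗w j)

    inSpan-0 : InSpan L (λ _ → 0ℚ)
    inSpan-0 = (λ _ → 0ℚ) , lincomb-0 L

    inSpan-⊕ : ∀ {u w} → InSpan L u → InSpan L w → InSpan L (u ⊕ w)
    inSpan-⊕ (c , lc≗u) (d , ld≗w) = (λ i → c i + d i) , λ j →
      trans (lincomb-+ L c d j) (cong₂ _+_ (lc≗u j) (ld≗w j))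

    inSpan-⊛ : ∀ a {u} → InSpan L u → InSpan L (a ⊛ u)
    inSpan-⊛ a (c , lc≗u) = (λ i → a * c i) , λ j → trans (lincomb-* L a c j) (cong (a *_) (lc≗u j))

    inSpan-⊝ : ∀ {u w} → InSpan L u → InSpan L w → InSpan L (u ⊝ w)
    inSpan-⊝ {u} {w} u∈ w∈ =
      inSpan-resp (λ j → solve 2 (λ x y → x :+ (:- con 1ℚ) :* y := x :- y) refl (u j) (w j))
                  (inSpan-⊕ u∈ (inSpan-⊛ (- 1ℚ) w∈))

  inSpan-∈ : ∀ {L v} → v ∈ L → InSpan L v
  inSpan-∈ {v ∷ L} (here refl) = (1ℚ Vector.∷ λ _ → 0ℚ) , λ j → begin
    1ℚ * v j + lincomb L (λ _ → 0ℚ) j ≡⟨ cong (1ℚ * v j +_) (lincomb-0 L j) ⟩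
    1ℚ * v j + 0ℚ                     ≡⟨ solve 1 (λ x → con 1ℚ :* x :+ con 0ℚ := x) refl (v j) ⟩
    v j                               ∎
    where open ≡-Reasoning
  inSpan-∈ {w ∷ L} {v} (there v∈L) with c , lc≗v ← inSpan-∈ v∈L = (0ℚ Vector.∷ c) , λ j → begin
    0ℚ * w j + lincomb L c j ≡⟨ cong (0ℚ * w j +_) (lc≗v j) ⟩
    0ℚ * w j + v j           ≡⟨ solve 2 (λ x y → con 0ℚ :* x :+ y := y) refl (w j) (v j) ⟩
    v j                      ∎
    where open ≡-Reasoning

  inSpan-∑ : ∀ {L : List (Vector ℚ n)} {k} (F : Fin k → Vector ℚ n) → (∀ m → InSpan L (F m)) →
             InSpan L (λ j → ∑[ m < k ] F m j)
  inSpan-∑ {k = zero}  F F∈ = inSpan-0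
  inSpan-∑ {k = suc k} F F∈ = inSpan-⊕ (F∈ zero) (inSpan-∑ (F ∘ suc) (F∈ ∘ suc))

∑-e : ∀ {k} (v : Vector ℚ k) → (λ j → ∑[ m < k ] (v m * e m j)) ≗ v
∑-e {suc k} v zero = begin
  v zero * 1ℚ + ∑[ m < k ] (v (suc m) * 0ℚ) ≡⟨ cong (v zero * 1ℚ +_) (∑-0 k (v ∘ suc)) ⟩
  v zero * 1ℚ + 0ℚ                          ≡⟨ solve 1 (λ x → x :* con 1ℚ :+ con 0ℚ := x) refl (v zero) ⟩
  v zero                                    ∎
  where
  open ≡-Reasoning
  ∑-0 : ∀ k (w : Vector ℚ k) → ∑[ m < k ] (w m * 0ℚ) ≡ 0ℚ
  ∑-0 zero    w = refl
  ∑-0 (suc k) w = cong₂ _+_ (ℚ.*-zeroʳ (w zero)) (∑-0 k (w ∘ suc))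
∑-e {suc k} v (suc j) = begin
  v zero * 0ℚ + ∑[ m < k ] (v (suc m) * e m j)
    ≡⟨ cong (v zero * 0ℚ +_) (∑-e (v ∘ suc) j) ⟩
  v zero * 0ℚ + v (suc j)
    ≡⟨ solve 2 (λ x y → x :* con 0ℚ :+ y := y) refl (v zero) (v (suc j)) ⟩
  v (suc j)
    ∎
  where open ≡-Reasoning

standardBasis⊆span⇒spans : ∀ {n} {L : List (Vector ℚ n)} → (∀ m → InSpan L (e m)) → Spans L
standardBasis⊆span⇒spans e∈ = ∀inSpan⇒spans λ v →
  inSpan-resp (∑-e v) (inSpan-∑ (λ m → v m ⊛ e m) (λ m → inSpan-⊛ (v m) (e∈ m)))

lincomb-map : ∀ {m k} (F : Vector ℚ m → Vector ℚ k) →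
              F (λ _ → 0ℚ) ≗ (λ _ → 0ℚ) → (∀ a u w → F ((a ⊛ u) ⊕ w) ≗ (a ⊛ F u) ⊕ F w) →
              ∀ K c → lincomb (map F K) (c ∘ cast (length-map F K)) ≗ F (lincomb K c)
lincomb-map F F-0 F-linear []      c j = sym (F-0 j)
lincomb-map F F-0 F-linear (w ∷ K) c j = begin
  c zero * F w j + lincomb (map F K) (c ∘ suc ∘ cast (length-map F K)) j
    ≡⟨ cong (c zero * F w j +_) (lincomb-map F F-0 F-linear K (c ∘ suc) j) ⟩
  c zero * F w j + F (lincomb K (c ∘ suc)) j
    ≡⟨ F-linear (c zero) w (lincomb K (c ∘ suc)) j ⟨
  F (lincomb (w ∷ K) c) j
    ∎
  where open ≡-Reasoning

module _ {m : ℕ} (v : Vector ℚ (suc m)) .{{_ : ℚ.NonZero (v zero)}} where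

  eliminate : Vector ℚ (suc m) → Vector ℚ m
  eliminate w j = w (suc j) - (w zero * 1/ v zero) * v (suc j)

  eliminate-cong : ∀ {w w'} → w ≗ w' → eliminate w ≗ eliminate w'
  eliminate-cong w≗w' j = cong₂ (λ x y → x - (y * 1/ v zero) * v (suc j)) (w≗w' (suc j)) (w≗w' zero)

  eliminate-0 : eliminate (λ _ → 0ℚ) ≗ (λ _ → 0ℚ)
  eliminate-0 j = solve 2 (λ k x → con 0ℚ :- (con 0ℚ :* k) :* x := con 0ℚ) refl (1/ v zero) (v (suc j))

  eliminate-linear : ∀ a u w → eliminate ((a ⊛ u) ⊕ w) ≗ (a ⊛ eliminate u) ⊕ eliminate w
  eliminate-linear a u w j =
    solve 7 (λ a u₀ u₁ w₀ w₁ k v₁ → (a :* u₁ :+ w₁) :- ((a :* u₀ :+ w₀) :* k) :* v₁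
                                   := a :* (u₁ :- (u₀ :* k) :* v₁) :+ (w₁ :- (w₀ :* k) :* v₁))
      refl a (u zero) (u (suc j)) (w zero) (w (suc j)) (1/ v zero) (v (suc j))

  eliminate-self : eliminate v ≗ (λ _ → 0ℚ)
  eliminate-self j = begin
    v (suc j) - (v zero * 1/ v zero) * v (suc j)
      ≡⟨ cong (λ x → v (suc j) - x * v (suc j)) (ℚ.*-inverseʳ (v zero)) ⟩
    v (suc j) - 1ℚ * v (suc j)
      ≡⟨ solve 1 (λ x → x :- con 1ℚ :* x := con 0ℚ) refl (v (suc j)) ⟩
    0ℚ
      ∎
    where open ≡-Reasoning

  eliminate-0∷ : ∀ u → eliminate (0ℚ Vector.∷ u) ≗ u
  eliminate-0∷ u j = solve 3 (λ x k y → x :- (con 0ℚ :* k) :* y := x) refl (u j) (1/ v zero) (v (suc j))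

eliminate-removeAt-spans : ∀ {m} (L : List (Vector ℚ (suc m))) i .{{_ : ℚ.NonZero (List.lookup L i zero)}} →
                           Spans L → Spans (map (eliminate (List.lookup L i)) (List.removeAt L i))
eliminate-removeAt-spans L i spans u with d , ld≗0∷u ← spans (0ℚ Vector.∷ u) =
  d′ ∘ cast (length-map (eliminate v) L′) , λ j → sym (begin
    u j                                        ≡⟨ eliminate-0∷ v u j ⟨
    eliminate v (0ℚ Vector.∷ u) j              ≡⟨ eliminate-cong v ld≗0∷u j ⟨
    eliminate v (lincomb L d) j                ≡⟨ eliminate-cong v (lincomb-removeAt L i d) j ⟩
    eliminate v ((d i ⊛ v) ⊕ lincomb L′ d′) j  ≡⟨ eliminate-linear v (d i) v (lincomb L′ d′) j ⟩
    d i * eliminate v v j + w j                ≡⟨ cong (λ x → d i * x + w j) (eliminate-self v j) ⟩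
    d i * 0ℚ + w j                             ≡⟨ solve 2 (λ a x → a :* con 0ℚ :+ x := x) refl (d i) (w j) ⟩
    w j                                        ≡⟨ lincomb-map (eliminate v) (eliminate-0 v) (eliminate-linear v)
                                                                  L′ d′ j ⟨
    lincomb (map (eliminate v) L′) (d′ ∘ cast (length-map (eliminate v) L′)) j ∎)
  where
  open ≡-Reasoning
  v  = List.lookup L i
  L′ = List.removeAt L i
  d′ = d ∘ keptIndex L i
  w  = eliminate v (lincomb L′ d′)

spans⇒≤length : ∀ {m} (L : List (Vector ℚ m)) → Spans L → m ≤ length L
spans⇒≤length {zero}  L spans = z≤n
spans⇒≤length {suc m} L spans with c , lc≗e₀ ← spans (e zero) = begin
  suc m            ≤⟨ s≤s (spans⇒≤length W (eliminate-removeAt-spans L i spans)) ⟩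
  suc (length W)   ≡⟨ cong suc (length-map _ L′) ⟩
  suc (length L′)  ≡⟨ length-removeAt′ L i ⟨
  length L         ∎
  where
  open ≤-Reasoning
  pivot : ∃ λ i → List.lookup L i zero ≢ 0ℚ
  pivot = lincomb≢0⇒∃lookup≢0 L c zero λ lc₀≡0 → contradiction (trans (sym (lc≗e₀ zero)) lc₀≡0) λ ()
  i = proj₁ pivot
  instance
    Lᵢ₀≢0 : ℚ.NonZero (List.lookup L i zero)
    Lᵢ₀≢0 = ≢-nonZero (proj₂ pivot)
  L′ = List.removeAt L i
  W  = map (eliminate (List.lookup L i)) L′

module _ {n : ℕ} (L : List (Vector ℚ n)) (i : Fin (length L)) where

  removeAt-spans : InSpan (List.removeAt L i) (List.lookup L i) → Spans L → Spans (List.removeAt L i)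
  removeAt-spans Lᵢ∈ spans = ∀inSpan⇒spans λ v → let d , ld≗v = spans v in
    inSpan-resp (λ j → trans (sym (lincomb-removeAt L i d j)) (ld≗v j))
                (inSpan-⊕ (inSpan-⊛ (d i) Lᵢ∈) (d ∘ keptIndex L i , λ _ → refl))

  dependent⇒inSpan-removeAt : ∀ c → lincomb L c ≗ (λ _ → 0ℚ) → c i ≢ 0ℚ →
                              InSpan (List.removeAt L i) (List.lookup L i)
  dependent⇒inSpan-removeAt c lc≗0 cᵢ≢0 =
    inSpan-resp (λ j → sym (c*x+s≡0⇒x≡-s/c (c i) _ _ (trans (sym (lincomb-removeAt L i c j)) (lc≗0 j))))
                (inSpan-⊛ (- (1/ c i)) (c ∘ keptIndex L i , λ _ → refl))
    where
    instance
      cᵢ≢0′ : ℚ.NonZero (c i)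
      cᵢ≢0′ = ≢-nonZero cᵢ≢0

spans⇒linIndep : ∀ {n} (L : List (Vector ℚ n)) → Spans L → length L ≤ n → LinIndep L
spans⇒linIndep {n} L spans length≤n c lc≗0 i with c i ℚ.≟ 0ℚ
... | yes cᵢ≡0 = cᵢ≡0
... | no  cᵢ≢0 = contradiction
  (spans⇒≤length (List.removeAt L i) (removeAt-spans L i (dependent⇒inSpan-removeAt L i c lc≗0 cᵢ≢0) spans))
  (<⇒≱ (subst (_≤ n) (length-removeAt′ L i) length≤n))

infix 4 _≈±_

_≈±_ : ℚ → ℚ → Set
a ≈± b = a ≡ b ⊎ a ≡ - b

≈±-* : ∀ {a b c d} → a ≈± b → c ≈± d → a * c ≈± b * d
≈±-* (inj₁ refl) (inj₁ refl) = inj₁ refl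
≈±-* {b = b} {d = d} (inj₁ refl) (inj₂ refl) = inj₂ (solve 2 (λ b d → b :* (:- d) := :- (b :* d)) refl b d)
≈±-* {b = b} {d = d} (inj₂ refl) (inj₁ refl) = inj₂ (solve 2 (λ b d → (:- b) :* d := :- (b :* d)) refl b d)
≈±-* {b = b} {d = d} (inj₂ refl) (inj₂ refl) = inj₁ (solve 2 (λ b d → (:- b) :* (:- d) := b :* d) refl b d)

≈±-factor : ∀ {a b c d} → a ≈± b → c ≈± b * d → ∃ λ x → x ≈± d × c ≡ a * x
≈±-factor {d = d} (inj₁ refl) (inj₁ refl) = d , inj₁ refl , refl
≈±-factor {b = b} {d = d} (inj₁ refl) (inj₂ refl) =
  - d , inj₂ refl , solve 2 (λ b d → :- (b :* d) := b :* (:- d)) refl b d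
≈±-factor {b = b} {d = d} (inj₂ refl) (inj₁ refl) =
  - d , inj₂ refl , solve 2 (λ b d → b :* d := (:- b) :* (:- d)) refl b d
≈±-factor {b = b} {d = d} (inj₂ refl) (inj₂ refl) =
  d , inj₁ refl , solve 2 (λ b d → :- (b :* d) := (:- b) :* d) refl b d

≈±-≢0 : ∀ {a b} → a ≈± b → b ≢ 0ℚ → a ≢ 0ℚ
≈±-≢0 (inj₁ refl) b≢0 = b≢0
≈±-≢0 (inj₂ refl) b≢0 -b≡0 = b≢0 (ℚ.neg-injective -b≡0)

+/1≡mkℚ : ∀ a → ℤ.+ a / 1 ≡ mkℚ (ℤ.+ a) 0 (coprime-sym (1-coprimeTo a))
+/1≡mkℚ a = ℚ.normalize-coprime (coprime-sym (1-coprimeTo a))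

+/1-* : ∀ a b → ℤ.+ (a ℕ.* b) / 1 ≡ (ℤ.+ a / 1) * (ℤ.+ b / 1)
+/1-* a b rewrite +/1≡mkℚ a | +/1≡mkℚ b = cong (_/ 1) (ℤ.pos-* a b)

↥-+/1 : ∀ a → ↥ (ℤ.+ a / 1) ≡ ℤ.+ a
↥-+/1 a = cong ↥_ (+/1≡mkℚ a)

≈±+/1⇒≢1 : ∀ {a A} → 1 < a → A ≈± ℤ.+ a / 1 → A ≢ 1ℚ
≈±+/1⇒≢1 {a} 1<a (inj₁ refl) a/1≡1 = <⇒≢ 1<a (sym (ℤ.+-injective (trans (sym (↥-+/1 a)) (cong ↥_ a/1≡1))))
≈±+/1⇒≢1 {a} 1<a (inj₂ refl) -a/1≡1 = -m≢+1 (begin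
  ℤ.- (ℤ.+ a)        ≡⟨ cong ℤ.-_ (↥-+/1 a) ⟨
  ℤ.- ↥ (ℤ.+ a / 1)  ≡⟨ ℚ.↥-neg (ℤ.+ a / 1) ⟨
  ↥ (- (ℤ.+ a / 1))  ≡⟨ cong ↥_ -a/1≡1 ⟩
  ℤ.+ 1              ∎)
  where
  open ≡-Reasoning
  -m≢+1 : ∀ {m} → ℤ.- (ℤ.+ m) ≢ ℤ.+ 1
  -m≢+1 {zero}  ()
  -m≢+1 {suc m} ()

module _ (p : ℕ) where

  pow-suc : ∀ k → pow p (suc k) ≡ pow p k * pow p 1
  pow-suc k = trans (cong (λ m → ℤ.+ m / 1) (trans (cong (p ℕ.^_) (+-comm 1 k)) (^-distribˡ-+-* p k 1)))
                    (+/1-* (p ℕ.^ k) (p ℕ.^ 1))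

  pow≢0 : .{{_ : NonZero p}} → ∀ k → pow p k ≢ 0ℚ
  pow≢0 k pᵏ≡0 = <⇒≢ (m^n>0 p k) (sym (ℤ.+-injective (trans (sym (↥-+/1 (p ℕ.^ k))) (cong ↥_ pᵏ≡0))))

module _ {n : ℕ} .{{_ : NonZero n}} (p : ℕ) (R : Subset n) where

  lam-shape : ∀ r k → ∃ λ A → A ≈± pow p k × lam p R r k ≗ e r ⊕ (A ⊛ e (r ⊖ k))
  lam-shape r k = shape (does (k ℕ.≟ gap R r))
    where
    shape : ∀ b → ∃ λ A → A ≈± pow p k ×
            (if b then e r ⊝ (pow p k ⊛ e (r ⊖ k)) else e r ⊕ (pow p k ⊛ e (r ⊖ k))) ≗ e r ⊕ (A ⊛ e (r ⊖ k))
    shape true  = - pow p k , inj₂ refl , λ j →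
      solve 3 (λ x P y → x :- P :* y := x :+ (:- P) :* y) refl (e r j) (pow p k) (e (r ⊖ k) j)
    shape false = pow p k , inj₁ refl , λ _ → refl

  -- lambdas n p R unfolds to concatMap lambdaBlock (allFin n).
  lambdaBlock : Fin n → List (Vector ℚ n)
  lambdaBlock r = if lookup R r then [] else map (λ k → lam p R r (suc k)) (upTo (gap R r))

  lam∈lambdas : ∀ {r k} → lookup R r ≡ false → k < gap R r → lam p R r (suc k) ∈ lambdas n p R
  lam∈lambdas {r} {k} r∉R k<gap = ∈-concat⁺′ lam∈block (∈-map⁺ lambdaBlock (∈-allFin r))
    where
    lam∈block : lam p R r (suc k) ∈ lambdaBlock r
    lam∈block rewrite r∉R = ∈-map⁺ _ (∈-upTo⁺ k<gap)

  length-lambdas≤n : length (lambdas n p R) ≤ n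
  length-lambdas≤n = subst (_≤ n) (sym (length-concatMap-cong block-length (allFin n)))
                           (Unique⇒length≤ (positions-unique R))
    where
    block-length : ∀ r → length (lambdaBlock r) ≡ length (blockPositions R r)
    block-length r with lookup R r
    ... | true  = refl
    ... | false = begin
      length (map (λ k → lam p R r (suc k)) (upTo (gap R r))) ≡⟨ length-map _ (upTo (gap R r)) ⟩
      length (upTo (gap R r))                                 ≡⟨ length-upTo (gap R r) ⟩
      gap R r                                                 ≡⟨ length-applyUpTo (r ⊖_) (gap R r) ⟨
      length (applyUpTo (r ⊖_) (gap R r))                     ∎
      where open ≡-Reasoning

module _ {n : ℕ} .{{_ : NonZero n}} (p : ℕ) .{{_ : NonZero p}} (R : Subset n) where

  e⊕±pow⊛e-inSpan : ∀ {r k} → lookup R r ≡ false → k ≤ gap R r →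
                    ∃ λ A → A ≈± pow p k × InSpan (lambdas n p R) (e r ⊕ (A ⊛ e (r ⊖ k)))
  e⊕±pow⊛e-inSpan {r} {zero} _ _ = - 1ℚ , inj₂ refl , inSpan-resp (λ j → begin
    0ℚ                          ≡⟨ solve 1 (λ x → con 0ℚ := x :+ (:- con 1ℚ) :* x) refl (e r j) ⟩
    e r j + - 1ℚ * e r j        ≡⟨ cong (λ s → e r j + - 1ℚ * e s j) (r⊖0≡r r) ⟨
    e r j + - 1ℚ * e (r ⊖ 0) j  ∎) inSpan-0
    where open ≡-Reasoning
  e⊕±pow⊛e-inSpan {r} {suc k} r∉R k<gap with A , A≈± , lam≗ ← lam-shape p R r (suc k) =
    A , A≈± , inSpan-resp lam≗ (inSpan-∈ (lam∈lambdas p R r∉R k<gap))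

  e⊝±p⊛e-inSpan : ∀ {x} → lookup R x ≡ false → ∀ j →
                  ∃ λ a → a ≈± pow p 1 × InSpan (lambdas n p R) (e j ⊝ (a ⊛ e (j ⊖ 1)))
  e⊝±p⊛e-inSpan x∉R j with inBlock R x∉R j
  ... | r , k , r∉R , k<gap , refl
      with A , A≈± , u∈ ← e⊕±pow⊛e-inSpan r∉R (<⇒≤ k<gap)
         | B , B≈± , w∈ ← e⊕±pow⊛e-inSpan r∉R k<gap
      with a , a≈± , B≡A*a ← ≈±-factor A≈± (subst (B ≈±_) (pow-suc p k) B≈±) =
    a , a≈± , inSpan-resp difference (inSpan-⊛ (1/ A) (inSpan-⊝ u∈ w∈))
    where
    instance
      A≢0 : ℚ.NonZero A
      A≢0 = ≢-nonZero (≈±-≢0 A≈± (pow≢0 p k))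
    difference : (1/ A) ⊛ ((e r ⊕ (A ⊛ e (r ⊖ k))) ⊝ (e r ⊕ (B ⊛ e (r ⊖ suc k)))) ≗
                 e (r ⊖ k) ⊝ (a ⊛ e ((r ⊖ k) ⊖ 1))
    difference i = begin
      1/ A * ((e r i + A * e (r ⊖ k) i) - (e r i + B * e (r ⊖ suc k) i))
        ≡⟨ cong₂ (λ b s → 1/ A * ((e r i + A * e (r ⊖ k) i) - (e r i + b * e s i)))
                 B≡A*a (sym (⊖-⊖ r k 1 (≤-trans k<gap (gap≤n R r)))) ⟩
      1/ A * ((e r i + A * e (r ⊖ k) i) - (e r i + (A * a) * e ((r ⊖ k) ⊖ 1) i))
        ≡⟨ cong (1/ A *_) (solve 5 (λ x A y a z → (x :+ A :* y) :- (x :+ (A :* a) :* z)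
                                                 := A :* (y :- a :* z))
                                   refl (e r i) A (e (r ⊖ k) i) a (e ((r ⊖ k) ⊖ 1) i)) ⟩
      1/ A * (A * (e (r ⊖ k) i - a * e ((r ⊖ k) ⊖ 1) i))
        ≡⟨ 1/x*[x*y]≡y A _ ⟩
      e (r ⊖ k) i - a * e ((r ⊖ k) ⊖ 1) i
        ∎
      where open ≡-Reasoning

  e⊝±pow⊛e-inSpan : ∀ {x} → lookup R x ≡ false → ∀ j {t} → t ≤ n →
                    ∃ λ A → A ≈± pow p t × InSpan (lambdas n p R) (e j ⊝ (A ⊛ e (j ⊖ t)))
  e⊝±pow⊛e-inSpan x∉R j {zero} _ = 1ℚ , inj₁ refl , inSpan-resp (λ i → begin
    0ℚ                       ≡⟨ solve 1 (λ x → con 0ℚ := x :- con 1ℚ :* x) refl (e j i) ⟩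
    e j i - 1ℚ * e j i       ≡⟨ cong (λ s → e j i - 1ℚ * e s i) (r⊖0≡r j) ⟨
    e j i - 1ℚ * e (j ⊖ 0) i ∎) inSpan-0
    where open ≡-Reasoning
  e⊝±pow⊛e-inSpan x∉R j {suc t} 1+t≤n
    with A , A≈± , T ← e⊝±pow⊛e-inSpan x∉R j (≤-trans (n≤1+n t) 1+t≤n)
       | a , a≈± , S ← e⊝±p⊛e-inSpan x∉R (j ⊖ t) =
    A * a , subst (A * a ≈±_) (sym (pow-suc p t)) (≈±-* A≈± a≈±) ,
    inSpan-resp sum (inSpan-⊕ T (inSpan-⊛ A S))
    where
    sum : (e j ⊝ (A ⊛ e (j ⊖ t))) ⊕ (A ⊛ (e (j ⊖ t) ⊝ (a ⊛ e ((j ⊖ t) ⊖ 1)))) ≗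
          e j ⊝ ((A * a) ⊛ e (j ⊖ suc t))
    sum i = begin
      (e j i - A * e (j ⊖ t) i) + A * (e (j ⊖ t) i - a * e ((j ⊖ t) ⊖ 1) i)
        ≡⟨ solve 5 (λ x A y a z → (x :- A :* y) :+ A :* (y :- a :* z) := x :- (A :* a) :* z) refl
             (e j i) A (e (j ⊖ t) i) a (e ((j ⊖ t) ⊖ 1) i) ⟩
      e j i - (A * a) * e ((j ⊖ t) ⊖ 1) i
        ≡⟨ cong (λ s → e j i - (A * a) * e s i) (⊖-⊖ j t 1 1+t≤n) ⟩
      e j i - (A * a) * e (j ⊖ suc t) i
        ∎
      where open ≡-Reasoning

module _ {n : ℕ} .{{_ : NonZero n}} (p : ℕ) (1<p : 1 < p) (R : Subset n) where

  private instance
    p≢0 : NonZero p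
    p≢0 = >-nonZero (<⇒≤ 1<p)

  e-inSpan : ∀ {x} → lookup R x ≡ false → ∀ j → InSpan (lambdas n p R) (e j)
  e-inSpan x∉R j with A , A≈± , T ← e⊝±pow⊛e-inSpan p R x∉R j ≤-refl =
    inSpan-resp solve-for-e (inSpan-⊛ (1/ (1ℚ - A)) T)
    where
    1-A≢0 : 1ℚ - A ≢ 0ℚ
    1-A≢0 1-A≡0 = ≈±+/1⇒≢1 (^-monoʳ-< p 1<p (>-nonZero⁻¹ n)) A≈± (sym (x∙y⁻¹≈ε⇒x≈y 1ℚ A 1-A≡0))
    instance
      1-A≢0′ : ℚ.NonZero (1ℚ - A)
      1-A≢0′ = ≢-nonZero 1-A≢0
    solve-for-e : (1/ (1ℚ - A)) ⊛ (e j ⊝ (A ⊛ e (j ⊖ n))) ≗ e j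
    solve-for-e i = begin
      1/ (1ℚ - A) * (e j i - A * e (j ⊖ n) i)
        ≡⟨ cong (λ s → 1/ (1ℚ - A) * (e j i - A * e s i)) (r⊖n≡r j) ⟩
      1/ (1ℚ - A) * (e j i - A * e j i)
        ≡⟨ cong (1/ (1ℚ - A) *_) (solve 2 (λ A x → x :- A :* x := (con 1ℚ :- A) :* x) refl A (e j i)) ⟩
      1/ (1ℚ - A) * ((1ℚ - A) * e j i)
        ≡⟨ 1/x*[x*y]≡y (1ℚ - A) (e j i) ⟩
      e j i
        ∎
      where open ≡-Reasoning

  lambdas-isBasis : ∀ {x} → lookup R x ≡ false → IsBasis (lambdas n p R)
  lambdas-isBasis x∉R = spans⇒linIndep (lambdas n p R) spans (length-lambdas≤n p R) , spans
    where
    spans : Spans (lambdas n p R)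
    spans = standardBasis⊆span⇒spans (e-inSpan x∉R)

∉⇒lookup≡false : ∀ {n} {R : Subset n} {x} → x ∉ R → lookup R x ≡ false
∉⇒lookup≡false {R = R} {x} x∉R with lookup R x in Rₓ
... | true  = contradiction (lookup⇒[]= x R Rₓ) x∉R
... | false = refl

lemma5p11p2 : (n : ℕ) → .{{_ : NonZero n}} → (p : ℕ) → Prime p →
    (R : Subset n) → (∃ λ (x : Fin n) → x ∉ R) →
    IsBasis (lambdas n p R)
lemma5p11p2 n p p-prime R (x , x∉R) =
  lambdas-isBasis p (nonTrivial⇒n>1 p {{prime⇒nonTrivial p-prime}}) R (∉⇒lookup≡false x∉R)
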